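{- For every clopen subset $U$ of $X$, the set $\bigcup_{u\in U}Q_u$ is a clopen subset of $Q$ that is both an up-set and a down-set.
   Context: Let $X$ be the Stone space of the Boolean algebra of all subsets of $\mathbb N$ (the Stone–Čech compactification of discrete $\mathbb N$), a compact totally disconnected space containing $\mathbb N$ with each $\{z\}$, $z\in\mathbb N$, open. For $z\in\mathbb N$ let $Q_z=\{g_z,a_z,b_z,c_z\}$ (four distinct elements) with $g_z<a_z,b_z,c_z$ and $a_z,b_z,c_z$ pairwise incomparable. For $x\in X\setminus\mathbb N$ let $Q_x=\{g_x,a_x,b_x\}$ with $g_x<a_x,b_x$, $a_x,b_x$ incomparable, and set $c_x:=a_x$. Let $Q$ be the disjoint union of the posets $Q_x$ ($x\in X$) (elements of distinct $Q_x$ incomparable), with the topology whose subbasis for the closed sets consists of the sets $\{a_u:u\in U\}$, $\{b_u:u\in U\}$, $\{c_u:u\in U\}$, $\{g_u:u\in U\}$ for $U$ clopen in $X$. -}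

module Defs where

open import Data.Nat using (ℕ; _≡ᵇ_)
open import Data.Bool using (Bool; true; false; _∧_; not)
open import Data.Product using (Σ; _×_; _,_)
open import Data.List using (List)
open import Data.List.Relation.Unary.All using (All)
open import Data.List.Relation.Unary.Any using (Any)
open import Relation.Binary.PropositionalEquality using (_≡_)
open import Function.Bundles using (_⇔_)

-- The Boolean algebra of all subsets of ℕ (subsets as characteristic
-- functions ℕ → Bool) and its Stone space X: the Boolean homomorphisms
-- P(ℕ) → 2 (equivalently, ultrafilters on ℕ).

Subsetℕ : Set
Subsetℕ = ℕ → Bool

record X : Set where
  field
    hom    : Subsetℕ → Bool
    hom-ext : ∀ {A B : Subsetℕ} → (∀ n → A n ≡ B n) → hom A ≡ hom B
    hom-top : hom (λ _ → true) ≡ true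
    hom-∧  : ∀ (A B : Subsetℕ) → hom (λ n → A n ∧ B n) ≡ hom A ∧ hom B
    hom-not : ∀ (A : Subsetℕ) → hom (λ n → not (A n)) ≡ not (hom A)
open X public

SubsetX : Set
SubsetX = X → Bool

-- Stone topology: basic open (clopen) sets  [A] = { x | x(A) = 1 }
OpenX : SubsetX → Set
OpenX U = ∀ x → U x ≡ true →
  Σ Subsetℕ λ A → (hom x A ≡ true) × (∀ y → hom y A ≡ true → U y ≡ true)

ClosedX : SubsetX → Set
ClosedX U = OpenX (λ x → not (U x))

ClopenX : SubsetX → Set
ClopenX U = OpenX U × ClosedX U

-- ℕ inside X: principal homomorphisms  z ↦ (A ↦ A z)
singleton : ℕ → Subsetℕ
singleton z n = z ≡ᵇ n

-- x ∈ X ∖ ℕ : x is not a principal ultrafilter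
NonPrincipal : X → Set
NonPrincipal x = ∀ z → hom x (singleton z) ≡ false

principal : ℕ → X
principal z = record
  { hom = λ A → A z
  ; hom-ext = λ e → e z
  ; hom-top = Relation.Binary.PropositionalEquality.refl
  ; hom-∧ = λ A B → Relation.Binary.PropositionalEquality.refl
  ; hom-not = λ A → Relation.Binary.PropositionalEquality.refl
  }

-- The poset Q.  For z ∈ ℕ, Q_z = {g_z, a_z, b_z, c_z};
-- for x ∈ X ∖ ℕ, Q_x = {g_x, a_x, b_x} with c_x := a_x.

data Lbl4 : Set where
  g a b c : Lbl4

data Lbl3 : Set where
  g′ a′ b′ : Lbl3

data Q : Set where
  qℕ : ℕ → Lbl4 → Q
  qX : (x : X) → NonPrincipal x → Lbl3 → Q

base : Q → X
base (qℕ z _)   = principal z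
base (qX x _ _) = x

data _<Q_ : Q → Q → Set where
  gaℕ : ∀ {z} → qℕ z g <Q qℕ z a
  gbℕ : ∀ {z} → qℕ z g <Q qℕ z b
  gcℕ : ∀ {z} → qℕ z g <Q qℕ z c
  gaX : ∀ {x p} → qX x p g′ <Q qX x p a′
  gbX : ∀ {x p} → qX x p g′ <Q qX x p b′

data _≤Q_ : Q → Q → Set where
  ≤-refl : ∀ {q} → q ≤Q q
  ≤-lt   : ∀ {p q} → p <Q q → p ≤Q q

SubsetQ : Set
SubsetQ = Q → Bool

UpSet : SubsetQ → Set
UpSet S = ∀ p q → p ≤Q q → S p ≡ true → S q ≡ true

DownSet : SubsetQ → Set
DownSet S = ∀ p q → p ≤Q q → S q ≡ true → S p ≡ true

-- membership tests for the labels (c_x = a_x for x ∉ ℕ)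
isA isB isC isG : Q → Bool
isA (qℕ _ a) = true
isA (qℕ _ _) = false
isA (qX _ _ a′) = true
isA (qX _ _ _) = false
isB (qℕ _ b) = true
isB (qℕ _ _) = false
isB (qX _ _ b′) = true
isB (qX _ _ _) = false
isC (qℕ _ c) = true
isC (qℕ _ _) = false
isC (qX _ _ a′) = true
isC (qX _ _ _) = false
isG (qℕ _ g) = true
isG (qℕ _ _) = false
isG (qX _ _ g′) = true
isG (qX _ _ _) = false

data Kind : Set where
  kA kB kC kG : Kind

kindTest : Kind → Q → Bool
kindTest kA = isA
kindTest kB = isB
kindTest kC = isC
kindTest kG = isG

labelSet : Kind → SubsetX → SubsetQ
labelSet k U q = U (base q) ∧ kindTest k q

-- subbasis for the closed sets of Q
Subbasic : SubsetQ → Set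
Subbasic S = Σ SubsetX λ U → Σ Kind λ k →
  ClopenX U × (∀ q → S q ≡ labelSet k U q)

-- closed sets of the topology generated by the closed subbasis:
-- arbitrary intersections of finite unions of subbasic closed sets
ClosedQ : SubsetQ → Set₁
ClosedQ C = Σ Set λ I → Σ (I → List SubsetQ) λ F →
  (∀ i → All Subbasic (F i)) ×
  (∀ q → (C q ≡ true) ⇔ (∀ i → Any (λ S → S q ≡ true) (F i)))

OpenQ : SubsetQ → Set₁
OpenQ O = ClosedQ (λ q → not (O q))

ClopenQ : SubsetQ → Set₁
ClopenQ S = ClosedQ S × OpenQ S

⋃Q : SubsetX → SubsetQ
⋃Q U q = U (base q)

{-# OPTIONS --safe #-}
module Submission where

-- Q_u lies entirely over the point u, so order relations never leave a fibre and ⋃Q U is both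
-- an up-set and a down-set.  Each fibre is covered by its four labelled points, so ⋃Q U is the
-- finite union of the subbasic closed sets {a_u}, {b_u}, {c_u}, {g_u} over u ∈ U; its complement
-- is the same union over the clopen set X ∖ U, hence also closed.

open import Defs
open import Data.Product using (_×_; _,_; proj₂)
open import Data.Bool using (true; _∧_; not)
open import Data.Bool.Properties using (not-involutive)
open import Data.Unit using (⊤; tt)
open import Data.List using (List; _∷_; []; map)
open import Data.List.Relation.Unary.All using (All; tabulate)
open import Data.List.Relation.Unary.Any using (Any; here; there; satisfied)
import Data.List.Relation.Unary.All.Properties as All
import Data.List.Relation.Unary.Any.Properties as Any
open import Data.List.Membership.Propositional using (_∈_; lose)
open import Relation.Binary.PropositionalEquality using (_≡_; refl; sym; trans; cong₂; subst)
open import Function.Bundles using (_⇔_; mk⇔; Equivalence)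

∧-true-left : ∀ {x y} → x ∧ y ≡ true → x ≡ true
∧-true-left {true} _ = refl

OpenX-resp : ∀ {U V : SubsetX} → (∀ x → U x ≡ V x) → OpenX U → OpenX V
OpenX-resp U≗V openU x Vx with openU x (trans (U≗V x) Vx)
... | A , xA , [A]⊆U = A , xA , λ y yA → trans (sym (U≗V y)) ([A]⊆U y yA)

ClopenX-∁ : ∀ {U} → ClopenX U → ClopenX (λ x → not (U x))
ClopenX-∁ {U} (openU , closedU) =
  closedU , OpenX-resp (λ x → sym (not-involutive (U x))) openU

≤Q⇒base≡ : ∀ {p q} → p ≤Q q → base p ≡ base q
≤Q⇒base≡ ≤-refl     = refl
≤Q⇒base≡ (≤-lt gaℕ) = refl
≤Q⇒base≡ (≤-lt gbℕ) = refl
≤Q⇒base≡ (≤-lt gcℕ) = refl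
≤Q⇒base≡ (≤-lt gaX) = refl
≤Q⇒base≡ (≤-lt gbX) = refl

⋃Q-upSet : ∀ U → UpSet (⋃Q U)
⋃Q-upSet U p q p≤q = subst (λ u → U u ≡ true) (≤Q⇒base≡ p≤q)

⋃Q-downSet : ∀ U → DownSet (⋃Q U)
⋃Q-downSet U p q p≤q = subst (λ u → U u ≡ true) (sym (≤Q⇒base≡ p≤q))

ClosedQ-finiteUnion : ∀ {C} (F : List SubsetQ) → All Subbasic F →
  (∀ q → (C q ≡ true) ⇔ Any (λ S → S q ≡ true) F) → ClosedQ C
ClosedQ-finiteUnion F subbasicF C≡⋃F =
  ⊤ , (λ _ → F) , (λ _ → subbasicF) ,
  λ q → let open Equivalence (C≡⋃F q) in mk⇔ (λ Cq _ → to Cq) (λ ⋃Fq → from (⋃Fq tt))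

kinds : List Kind
kinds = kA ∷ kB ∷ kC ∷ kG ∷ []

kind-∈-kinds : ∀ k → k ∈ kinds
kind-∈-kinds kA = here refl
kind-∈-kinds kB = there (here refl)
kind-∈-kinds kC = there (there (here refl))
kind-∈-kinds kG = there (there (there (here refl)))

kindOf : Q → Kind
kindOf (qℕ _ g)    = kG
kindOf (qℕ _ a)    = kA
kindOf (qℕ _ b)    = kB
kindOf (qℕ _ c)    = kC
kindOf (qX _ _ g′) = kG
kindOf (qX _ _ a′) = kA
kindOf (qX _ _ b′) = kB

kindTest-kindOf : ∀ q → kindTest (kindOf q) q ≡ true
kindTest-kindOf (qℕ _ g)    = refl
kindTest-kindOf (qℕ _ a)    = refl
kindTest-kindOf (qℕ _ b)    = refl
kindTest-kindOf (qℕ _ c)    = refl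
kindTest-kindOf (qX _ _ g′) = refl
kindTest-kindOf (qX _ _ a′) = refl
kindTest-kindOf (qX _ _ b′) = refl

labelSetOf : SubsetX → Kind → SubsetQ
labelSetOf U k = labelSet k U

labelSets : SubsetX → List SubsetQ
labelSets U = map (labelSetOf U) kinds

⋃Q⇔any-labelSets : ∀ U q → (⋃Q U q ≡ true) ⇔ Any (λ S → S q ≡ true) (labelSets U)
⋃Q⇔any-labelSets U q = mk⇔ covered inLabelSet
  where
  covered : U (base q) ≡ true → Any (λ S → S q ≡ true) (labelSets U)
  covered Uq = Any.map⁺ {f = labelSetOf U} {xs = kinds}
    (lose (kind-∈-kinds (kindOf q)) (cong₂ _∧_ Uq (kindTest-kindOf q)))

  inLabelSet : Any (λ S → S q ≡ true) (labelSets U) → U (base q) ≡ true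
  inLabelSet q∈⋃ =
    ∧-true-left (proj₂ (satisfied (Any.map⁻ {f = labelSetOf U} {xs = kinds} q∈⋃)))

⋃Q-closed : ∀ {U} → ClopenX U → ClosedQ (⋃Q U)
⋃Q-closed {U} clopenU = ClosedQ-finiteUnion (labelSets U)
  (All.map⁺ {xs = kinds} {f = labelSetOf U}
    (tabulate λ {k} _ → U , k , clopenU , λ _ → refl))
  (⋃Q⇔any-labelSets U)

lemma8 : (U : SubsetX) → ClopenX U →
    ClopenQ (⋃Q U) × UpSet (⋃Q U) × DownSet (⋃Q U)
lemma8 U clopenU =
  (⋃Q-closed clopenU , ⋃Q-closed (ClopenX-∁ clopenU)) ,
  ⋃Q-upSet U , ⋃Q-downSet U
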